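{- Let $n>1$ be an integer, let $D=\{d_1,\ldots,d_k\}$ be a set of positive proper divisors of $n$, and let $p$ be a prime with $p>n$. Setting $N = n\cdot p$, we have $\omega(X_N(D)) = \omega(X_n(D))$.
   Context: For an integer $m>1$ and a set $D$ of positive proper divisors of $m$, the gcd-graph $X_m(D)$ has vertex set $\mathbb{Z}_m=\{0,1,\ldots,m-1\}$, and two distinct vertices $a,b$ are adjacent if and only if $\gcd(a-b,m)\in D$. (Every element of $D$ is also a proper divisor of $N$.) $\omega$ denotes the clique number. -}

module Defs where

open import Data.Nat using (ℕ; _<_; ∣_-_∣)
open import Data.Nat.GCD using (gcd)
open import Data.Fin using (Fin; toℕ)
open import Data.List using (List; length)
open import Data.List.Membership.Propositional using (_∈_)
open import Data.List.Relation.Unary.AllPairs using (AllPairs)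
open import Data.Product using (_×_; Σ)
open import Relation.Binary.PropositionalEquality using (_≡_)
open import Relation.Nullary using (¬_)

-- Adjacency in the gcd-graph X_m(D) on vertex set Z_m = Fin m:
-- a ≠ b and gcd(a - b, m) ∈ D  (gcd(a-b mod m, m) = gcd(|a-b|, m)).
Adj : (m : ℕ) → List ℕ → Fin m → Fin m → Set
Adj m D a b = (¬ (a ≡ b)) × (gcd ∣ toℕ a - toℕ b ∣ m ∈ D)

IsClique : (m : ℕ) → List ℕ → List (Fin m) → Set
IsClique m D xs = AllPairs (Adj m D) xs

IsCliqueNumber : (m : ℕ) → List ℕ → ℕ → Set
IsCliqueNumber m D w =
  Σ (List (Fin m)) (λ xs → IsClique m D xs × length xs ≡ w)
  × ((ys : List (Fin m)) → IsClique m D ys → Data.Nat._≤_ (length ys) w)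

-- Reduction mod n is a graph homomorphism X_{np}(D) → X_n(D): every d ∈ D divides n, so
-- gcd(a - b, np) ∈ D equals gcd(a - b, n) = gcd(a mod n - b mod n, n), and n ∉ D keeps
-- adjacent vertices apart. Conversely Z_n ⊆ Z_{np} is a homomorphism X_n(D) → X_{np}(D):
-- distinct a, b ∈ Z_n satisfy 0 < |a - b| < n < p, so a - b is prime to p and
-- gcd(a - b, np) = gcd(a - b, n). Homomorphisms both ways preserve clique sizes both ways.
module Submission where

open import Defs
open import Data.Nat using (ℕ; _<_; _≤_; _+_; _∸_; _*_; _%_; _/_; ∣_-_∣; NonZero; ≢-nonZero; ≢-nonZero⁻¹; >-nonZero; z<s)
open import Data.Nat.Properties
open import Data.Nat.Divisibility using (_∣_; divides; ∣-trans; ∣-antisym; m∣m*n)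
open import Data.Nat.DivMod
  using (m≡m%n+[m/n]*n; m%n<n; %-congˡ; %-remove-+ʳ; m∣n⇒o%n%m≡o%m)
open import Data.Nat.GCD using (gcd; gcd-greatest; gcd[m,n]∣m; gcd[m,n]∣n; gcd[m,n]≢0; gcd-identityˡ)
open import Data.Nat.Coprimality using (Coprime; coprime-divisor; prime⇒coprime)
import Data.Nat.Coprimality as Coprime
open import Data.Nat.Primality using (Prime; prime⇒nonZero)
open import Data.Fin using (Fin; toℕ; fromℕ<; inject≤)
open import Data.Fin.Properties using (toℕ<n; toℕ-fromℕ<; toℕ-inject≤; toℕ-injective; inject≤-injective)
open import Data.List using (List; map; length)
open import Data.List.Properties using (length-map)
open import Data.List.Membership.Propositional using (_∈_; _∉_)
import Data.List.Relation.Unary.AllPairs as AllPairs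
open import Data.List.Relation.Unary.AllPairs.Properties using (map⁺)
open import Data.Product using (_×_; _,_; proj₁; proj₂)
open import Data.Sum using (inj₁; inj₂)
open import Function using (_∘_; _⇔_; mk⇔)
open import Relation.Binary.PropositionalEquality

private
  variable
    m n : ℕ
    D : List ℕ

m%d≡n%d⇒d∣∣m-n∣ : ∀ m n d .{{_ : NonZero d}} → m % d ≡ n % d → d ∣ ∣ m - n ∣
m%d≡n%d⇒d∣∣m-n∣ m n d eq = divides ∣ m / d - n / d ∣ (begin
    ∣ m - n ∣
      ≡⟨ cong₂ ∣_-_∣ (m≡m%n+[m/n]*n m d) (trans (m≡m%n+[m/n]*n n d) (cong (_+ (n / d) * d) (sym eq))) ⟩
    ∣ m % d + (m / d) * d - m % d + (n / d) * d ∣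
      ≡⟨ ∣m+n-m+o∣≡∣n-o∣ (m % d) _ _ ⟩
    ∣ (m / d) * d - (n / d) * d ∣
      ≡⟨ *-distribʳ-∣-∣ d (m / d) (n / d) ⟨
    ∣ m / d - n / d ∣ * d ∎)
  where open ≡-Reasoning

d∣n∸m⇒n%d≡m%d : ∀ {m n d} .{{_ : NonZero d}} → m ≤ n → d ∣ n ∸ m → n % d ≡ m % d
d∣n∸m⇒n%d≡m%d {m} m≤n d∣n∸m = trans (%-congˡ (sym (m+[n∸m]≡n m≤n))) (%-remove-+ʳ m d∣n∸m)

d∣∣m-n∣⇒m%d≡n%d : ∀ m n d .{{_ : NonZero d}} → d ∣ ∣ m - n ∣ → m % d ≡ n % d
d∣∣m-n∣⇒m%d≡n%d m n d d∣ with ≤-total m n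
... | inj₁ m≤n = sym (d∣n∸m⇒n%d≡m%d m≤n (subst (d ∣_) (m≤n⇒∣m-n∣≡n∸m m≤n) d∣))
... | inj₂ n≤m = d∣n∸m⇒n%d≡m%d n≤m (subst (d ∣_) (m≤n⇒∣n-m∣≡n∸m n≤m) d∣)

module _ {n d : ℕ} .{{_ : NonZero n}} .{{_ : NonZero d}} (d∣n : d ∣ n) where

  private
    x%n%d≡x%d : ∀ x → x % n % d ≡ x % d
    x%n%d≡x%d x = m∣n⇒o%n%m≡o%m d n x d∣n

  d∣∣x-y∣⇒d∣∣x%n-y%n∣ : ∀ x y → d ∣ ∣ x - y ∣ → d ∣ ∣ x % n - y % n ∣
  d∣∣x-y∣⇒d∣∣x%n-y%n∣ x y d∣ = m%d≡n%d⇒d∣∣m-n∣ (x % n) (y % n) d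
    (trans (x%n%d≡x%d x) (trans (d∣∣m-n∣⇒m%d≡n%d x y d d∣) (sym (x%n%d≡x%d y))))

  d∣∣x%n-y%n∣⇒d∣∣x-y∣ : ∀ x y → d ∣ ∣ x % n - y % n ∣ → d ∣ ∣ x - y ∣
  d∣∣x%n-y%n∣⇒d∣∣x-y∣ x y d∣ = m%d≡n%d⇒d∣∣m-n∣ x y d
    (trans (sym (x%n%d≡x%d x)) (trans (d∣∣m-n∣⇒m%d≡n%d (x % n) (y % n) d d∣) (x%n%d≡x%d y)))

gcd[m,n]∣o⇒gcd[m,n]≡gcd[m,o] : ∀ m n o → o ∣ n → gcd m n ∣ o → gcd m n ≡ gcd m o
gcd[m,n]∣o⇒gcd[m,n]≡gcd[m,o] m n o o∣n gcd∣o = ∣-antisym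
  (gcd-greatest (gcd[m,n]∣m m n) gcd∣o)
  (gcd-greatest (gcd[m,n]∣m m o) (∣-trans (gcd[m,n]∣n m o) o∣n))

gcd[∣x%n-y%n∣,n]≡gcd[∣x-y∣,n] : ∀ x y n .{{_ : NonZero n}} →
                                gcd ∣ x % n - y % n ∣ n ≡ gcd ∣ x - y ∣ n
gcd[∣x%n-y%n∣,n]≡gcd[∣x-y∣,n] x y n = ∣-antisym
  (gcd-greatest (d∣∣x%n-y%n∣⇒d∣∣x-y∣ {{_}} {{gcd≢0 Y}} (gcd[m,n]∣n Y n) x y (gcd[m,n]∣m Y n))
                (gcd[m,n]∣n Y n))
  (gcd-greatest (d∣∣x-y∣⇒d∣∣x%n-y%n∣ {{_}} {{gcd≢0 X}} (gcd[m,n]∣n X n) x y (gcd[m,n]∣m X n))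
                (gcd[m,n]∣n X n))
  where
  X = ∣ x - y ∣
  Y = ∣ x % n - y % n ∣
  gcd≢0 : ∀ z → NonZero (gcd z n)
  gcd≢0 z = ≢-nonZero (gcd[m,n]≢0 z n (inj₂ (≢-nonZero⁻¹ n)))

coprime⇒gcd[m,n*p]≡gcd[m,n] : ∀ m n p → Coprime m p → gcd m (n * p) ≡ gcd m n
coprime⇒gcd[m,n*p]≡gcd[m,n] m n p m⊥p =
  gcd[m,n]∣o⇒gcd[m,n]≡gcd[m,o] m (n * p) n (m∣m*n p) (coprime-divisor gcd⊥p gcd∣p*n)
  where
  gcd⊥p : Coprime (gcd m (n * p)) p
  gcd⊥p (i∣gcd , i∣p) = m⊥p (∣-trans i∣gcd (gcd[m,n]∣m m (n * p)) , i∣p)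
  gcd∣p*n : gcd m (n * p) ∣ p * n
  gcd∣p*n = subst (gcd m (n * p) ∣_) (*-comm n p) (gcd[m,n]∣n m (n * p))

Homomorphism : ∀ {m k} → List ℕ → (Fin m → Fin k) → Set
Homomorphism {m} {k} D f = ∀ {a b} → Adj m D a b → Adj k D (f a) (f b)

homomorphism-preserves-cliques : ∀ {m k} {f : Fin m → Fin k} → Homomorphism D f →
                                 ∀ {xs} → IsClique m D xs → IsClique k D (map f xs)
homomorphism-preserves-cliques f-hom = map⁺ ∘ AllPairs.map f-hom

homomorphisms⇒isCliqueNumber : ∀ {m k w} {f : Fin m → Fin k} {g : Fin k → Fin m} →
                               Homomorphism D f → Homomorphism D g →
                               IsCliqueNumber m D w → IsCliqueNumber k D w
homomorphisms⇒isCliqueNumber {f = f} {g} f-hom g-hom ((xs , xs-clique , ∣xs∣≡w) , bound) =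
  (map f xs , homomorphism-preserves-cliques f-hom xs-clique , trans (length-map f xs) ∣xs∣≡w) ,
  λ ys ys-clique → subst (_≤ _) (length-map g ys)
                     (bound (map g ys) (homomorphism-preserves-cliques g-hom ys-clique))

reduceMod : ∀ {m} n .{{_ : NonZero n}} → Fin m → Fin n
reduceMod n a = fromℕ< (m%n<n (toℕ a) n)

reduceMod-homomorphism : .{{_ : NonZero n}} → n ∣ m → (∀ {d} → d ∈ D → d ∣ n) → n ∉ D →
                         Homomorphism D (reduceMod {m} n)
reduceMod-homomorphism {n} {m} {D} n∣m D∣n n∉D {a} {b} (_ , d∈D) =
  distinct , subst (_∈ D) (sym gcd≡d) d∈D
  where
  open ≡-Reasoning
  x = toℕ a
  y = toℕ b
  gcd≡d : gcd ∣ toℕ (reduceMod n a) - toℕ (reduceMod n b) ∣ n ≡ gcd ∣ x - y ∣ m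
  gcd≡d = begin
    gcd ∣ toℕ (reduceMod n a) - toℕ (reduceMod n b) ∣ n
      ≡⟨ cong₂ (λ u v → gcd ∣ u - v ∣ n) (toℕ-fromℕ< (m%n<n x n)) (toℕ-fromℕ< (m%n<n y n)) ⟩
    gcd ∣ x % n - y % n ∣ n
      ≡⟨ gcd[∣x%n-y%n∣,n]≡gcd[∣x-y∣,n] x y n ⟩
    gcd ∣ x - y ∣ n
      ≡⟨ gcd[m,n]∣o⇒gcd[m,n]≡gcd[m,o] ∣ x - y ∣ m n n∣m (D∣n d∈D) ⟨
    gcd ∣ x - y ∣ m ∎
  distinct : reduceMod n a ≢ reduceMod n b
  distinct eq = n∉D (subst (_∈ D) (sym n≡d) d∈D)
    where
    n≡d : n ≡ gcd ∣ x - y ∣ m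
    n≡d = begin
      n                                                     ≡⟨ gcd-identityˡ n ⟨
      gcd 0 n                                               ≡⟨ cong (λ z → gcd z n) (m≡n⇒∣m-n∣≡0 (cong toℕ eq)) ⟨
      gcd ∣ toℕ (reduceMod n a) - toℕ (reduceMod n b) ∣ n ≡⟨ gcd≡d ⟩
      gcd ∣ x - y ∣ m                                       ∎

embed : ∀ {n} p .{{_ : NonZero p}} → Fin n → Fin (n * p)
embed {n} p a = inject≤ a (m≤m*n n p)

embed-homomorphism : ∀ {p} .{{_ : NonZero p}} → Prime p → n ≤ p → Homomorphism D (embed {n} p)
embed-homomorphism {n} {D} {p} p-prime n≤p {a} {b} (a≢b , e∈D) =
  distinct , subst (_∈ D) (sym gcd≡e) e∈D
  where
  x = toℕ a
  y = toℕ b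
  instance
    ∣x-y∣≢0 : NonZero ∣ x - y ∣
    ∣x-y∣≢0 = ≢-nonZero (a≢b ∘ toℕ-injective ∘ ∣m-n∣≡0⇒m≡n)
  ∣x-y∣<p : ∣ x - y ∣ < p
  ∣x-y∣<p = ≤-<-trans (∣m-n∣≤m⊔n x y) (<-≤-trans (⊔-lub (toℕ<n a) (toℕ<n b)) n≤p)
  gcd≡e : gcd ∣ toℕ (embed p a) - toℕ (embed p b) ∣ (n * p) ≡ gcd ∣ x - y ∣ n
  gcd≡e = trans (cong₂ (λ u v → gcd ∣ u - v ∣ (n * p)) (toℕ-inject≤ a _) (toℕ-inject≤ b _))
                (coprime⇒gcd[m,n*p]≡gcd[m,n] ∣ x - y ∣ n p (Coprime.sym (prime⇒coprime p-prime ∣x-y∣<p)))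
  distinct : embed p a ≢ embed p b
  distinct = a≢b ∘ inject≤-injective _ _ a b

proposition4p2 : (n : ℕ) → 1 < n → (D : List ℕ)
    → (∀ d → d ∈ D → (0 < d) × (d ∣ n) × (d < n))
    → (p : ℕ) → Prime p → n < p
    → (w : ℕ) → IsCliqueNumber (n * p) D w ⇔ IsCliqueNumber n D w
proposition4p2 n 1<n D D-divisors p p-prime n<p w =
  mk⇔ (homomorphisms⇒isCliqueNumber reduce-hom embed-hom)
      (homomorphisms⇒isCliqueNumber embed-hom reduce-hom)
  where
  instance
    n≢0 : NonZero n
    n≢0 = >-nonZero (<-trans z<s 1<n)
    p≢0 : NonZero p
    p≢0 = prime⇒nonZero p-prime
  n∉D : n ∉ D
  n∉D n∈D = <-irrefl refl (proj₂ (proj₂ (D-divisors n n∈D)))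
  reduce-hom : Homomorphism D (reduceMod {n * p} n)
  reduce-hom = reduceMod-homomorphism (m∣m*n p) (λ {d} d∈D → proj₁ (proj₂ (D-divisors d d∈D))) n∉D
  embed-hom : Homomorphism D (embed {n} p)
  embed-hom = embed-homomorphism p-prime (<⇒≤ n<p)
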